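{- Let $(D,s,t)$ be reduced, let $(\hat T,\{B_x\}_{x\in\hat T})$ be the $s$-rooted cut decomposition of $D$, and let $\hat P=x_1\ldots x_\ell$ be a degenerate path of $\hat T$ (listed from the node closest to the root). Then: (1) every out-branching of $D$ rooted at $s$ contains all arcs $x_ix_{i+1}$, $1\le i<\ell$; (2) every arc $x_jx_i\in A(D)$ with $j>i$ belongs to $R_s$; (3) for $i<\ell$, there is no arc of $D$ from $x_i$ to $B_y$, where $y$ is a descendant of $x_i$ in $\hat T$, other than the arc $x_ix_{i+1}$.
   Context: An out-tree (in-tree) is an oriented tree with exactly one vertex of in-degree zero (out-degree zero), its root; an out-branching (in-branching) of $D$ is a spanning out-tree (in-tree). For a digraph $D$ and $s,t\in V(D)$, call $(D,s,t)$ reduced if $D$ has an out-branching rooted at $s$, an in-branching rooted at $t$, and every arc of $D$ lies in some out-branching rooted at $s$ or some in-branching rooted at $t$ (in particular every vertex is reachable from $s$). $R_s$ is the set of arcs of $D$ contained in no out-branching rooted at $s$, and $R_t$ the set of arcs contained in no in-branching rooted at $t$. A vertex $v$ is bi-reachable from $r$ if there exist two internally vertex-disjoint directed paths from $r$ to $v$. For a digraph $H$ with at least two vertices and $r\in V(H)$ from which every vertex is reachable, the diblock $B_r$ of $r$ in $H$ is the set of vertices bi-reachable from $r$ together with $r$ and all out-neighbours of $r$. For $x\in B_r\setminus\{r\}$ let $X_x$ be the set of vertices $v\in V(H)\setminus B_r$ such that every directed path from $r$ to $v$ intersects $B_r$ for the last time in $x$; $x$ is a bottleneck of $B_r$ if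 $X_x\neq\emptyset$, and $L$ denotes the set of bottlenecks. The $r$-rooted cut decomposition of $H$ is the pair $(\hat T,\{B_x\}_{x\in\hat T})$ defined recursively: $B_r$ is the diblock of $r$ in $H$; for each $x\in L$ let $(\hat T_x,\mathcal B_x)$ be the $x$-rooted cut decomposition of $H[X_x\cup\{x\}]$; $\hat T$ is the rooted tree (whose nodes are vertices of $H$) with root $r$, children of $r$ equal to $L$, and subtree rooted at each $x\in L$ equal to $\hat T_x$; the collection of diblocks is $\{B_r\}\cup\bigcup_{x\in L}\mathcal B_x$. A diblock $B_x$ is degenerate if $x$ is an internal node of $\hat T$ and $|B_x|=2$. A path in $\hat T$ is monotone if it is a subpath of a path from the root of $\hat T$ to a leaf of $\hat T$; it is degenerate if it is monotone and $B_x$ is degenerate for every node $x$ on it. -}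

module Defs where

open import Data.Nat using (ℕ; zero; suc; _+_; _<_; _≤_)
open import Data.Fin using (Fin)
open import Data.List using (List; []; _∷_; _++_)
open import Data.List.Membership.Propositional using (_∈_)
open import Data.List.Relation.Unary.All using (All)
open import Data.List.Relation.Unary.Unique.Propositional using (Unique)
open import Data.Product using (Σ; ∃; ∃-syntax; _×_; _,_)
open import Data.Sum using (_⊎_)
open import Data.Unit using (⊤)
open import Relation.Nullary using (¬_)
open import Relation.Binary.PropositionalEquality using (_≡_; _≢_)
open import Relation.Binary.Construct.Closure.ReflexiveTransitive using (Star)

-- A (simple) digraph on vertex set Fin n is given by its arc relation:
-- A u v  means  uv ∈ A(D).  A set of arcs of D is a sub-relation F of A.
Rel : ℕ → Set₁
Rel n = Fin n → Fin n → Set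

IsOutBranching : ∀ {n} → Rel n → Fin n → Rel n → Set
IsOutBranching A s F =
  (∀ u v → F u v → A u v) ×
  (∀ u → ¬ F u s) ×
  (∀ v → v ≢ s → ∃[ u ] (F u v × (∀ w → F w v → w ≡ u))) ×
  (∀ v → Star F s v)

IsInBranching : ∀ {n} → Rel n → Fin n → Rel n → Set
IsInBranching A t F =
  (∀ u v → F u v → A u v) ×
  (∀ w → ¬ F t w) ×
  (∀ v → v ≢ t → ∃[ w ] (F v w × (∀ w' → F v w' → w' ≡ w))) ×
  (∀ v → Star (λ a b → F b a) t v)

Reduced : ∀ {n} → Rel n → Fin n → Fin n → Set₁
Reduced A s t =
  (∃[ F ] IsOutBranching A s F) ×
  (∃[ F ] IsInBranching A t F) ×
  (∀ u v → A u v →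
     (∃[ F ] (IsOutBranching A s F × F u v)) ⊎ (∃[ F ] (IsInBranching A t F × F u v)))

InRs : ∀ {n} → Rel n → Fin n → Fin n → Fin n → Set₁
InRs A s u v = A u v × (∀ F → IsOutBranching A s F → ¬ F u v)

module _ {n : ℕ} (A : Rel n) where

  VSet : Set₁
  VSet = Fin n → Set

  Full : VSet
  Full _ = ⊤

  data Walk (S : VSet) : Fin n → Fin n → Set where
    [_]  : ∀ {u} → S u → Walk S u u
    step : ∀ {u v w} → S u → A u v → Walk S v w → Walk S u w

  verts : ∀ {S u v} → Walk S u v → List (Fin n)
  verts ([_] {u} _) = u ∷ []
  verts (step {u} _ _ p) = u ∷ verts p

  IsPath : ∀ {S u v} → Walk S u v → Set
  IsPath p = Unique (verts p)

  InternallyDisjoint : ∀ {S u v} → Walk S u v → Walk S u v → Set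
  InternallyDisjoint {u = u} {v = v} p q =
    ∀ z → z ∈ verts p → z ∈ verts q → (z ≡ u ⊎ z ≡ v)

  BiReachable : VSet → Fin n → Fin n → Set
  BiReachable S r v =
    ∃[ p ] ∃[ q ] (IsPath {S} {r} {v} p × IsPath {S} {r} {v} q × InternallyDisjoint p q)

  Diblock : VSet → Fin n → VSet
  Diblock S r v = S v × (v ≡ r ⊎ A r v ⊎ BiReachable S r v)

  LastMeets : ∀ {S u v} → VSet → Walk S u v → Fin n → Set
  LastMeets B p x =
    B x × ∃[ pre ] ∃[ post ] (verts p ≡ pre ++ x ∷ post × All (λ z → ¬ B z) post)

  XSet : VSet → Fin n → Fin n → VSet
  XSet S r x v =
    S v × ¬ Diblock S r v × Walk S r v ×
    (∀ (p : Walk S r v) → IsPath p → LastMeets (Diblock S r) p x)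

  Bottleneck : VSet → Fin n → Fin n → Set
  Bottleneck S r x = Diblock S r x × x ≢ r × ∃[ v ] XSet S r x v

  Sub : VSet → Fin n → Fin n → VSet
  Sub S r x v = XSet S r x v ⊎ v ≡ x

  -- DecNode S₀ r₀ x S : x is a node of the r₀-rooted cut decomposition of
  -- D[S₀], and it arises as the root of the recursive sub-problem D[S]
  -- (so that B_x is the diblock of x in D[S]).
  data DecNode (S₀ : VSet) (r₀ : Fin n) : Fin n → VSet → Set₁ where
    root  : DecNode S₀ r₀ r₀ S₀
    child : ∀ {x S y} → DecNode S₀ r₀ x S → Bottleneck S x y →
            DecNode S₀ r₀ y (Sub S x y)

  Node : Fin n → Fin n → Set₁
  Node s x = ∃[ S ] DecNode Full s x S

  Child : Fin n → Fin n → Fin n → Set₁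
  Child s x y = ∃[ S ] (DecNode Full s x S × Bottleneck S x y)

  InBlock : Fin n → Fin n → Fin n → Set₁
  InBlock s x v = ∃[ S ] (DecNode Full s x S × Diblock S x v)

  Internal : Fin n → Fin n → Set₁
  Internal s x = Node s x × ∃[ y ] Child s x y

  Leaf : Fin n → Fin n → Set₁
  Leaf s x = Node s x × (∀ y → ¬ Child s x y)

  DegenerateBlock : Fin n → Fin n → Set₁
  DegenerateBlock s x =
    Internal s x ×
    ∃[ a ] ∃[ b ] (a ≢ b × (∀ v → (InBlock s x v → (v ≡ a ⊎ v ≡ b)) ×
                                  ((v ≡ a ⊎ v ≡ b) → InBlock s x v)))

  RootLeafPath : Fin n → (ℕ → Fin n) → ℕ → Set₁
  RootLeafPath s y m =
    y 0 ≡ s × (∀ i → i < m → Child s (y i) (y (suc i))) × Leaf s (y m)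

  MonotonePath : Fin n → (ℕ → Fin n) → ℕ → Set₁
  MonotonePath s x ℓ =
    1 ≤ ℓ × ∃[ y ] ∃[ m ] ∃[ k ]
      (RootLeafPath s y m × k + ℓ ≤ suc m × (∀ i → i < ℓ → x i ≡ y (k + i)))

  DegeneratePath : Fin n → (ℕ → Fin n) → ℕ → Set₁
  DegeneratePath s x ℓ =
    MonotonePath s x ℓ × (∀ i → i < ℓ → DegenerateBlock s (x i))

  Descendant : Fin n → Fin n → Fin n → Set₁
  Descendant s = Star (Child s)

module Submission where

-- Say that x dominates v when every walk of D from s to v
-- visits x.  The s-rooted cut decomposition is governed by domination:
-- if a node x of T̂ arises as the root of the sub-problem D[S], then S is
-- (up to double negation, since membership in S need not be decidable)
-- exactly the set of vertices dominated by x.  This invariant holds at the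
-- root and passes from x to each bottleneck y, the key point being that a
-- vertex y strictly dominated by x dominates no other vertex of B_x.
-- Hence every node dominates all blocks below it, and if B_x = {x, y} is
-- degenerate then y is the only out-neighbour of x dominated by x (any
-- other one would be a third vertex of B_x).  The theorem follows:
--  (1) an out-branching leaves x_i for the last time, on its way to x_{i+1},
--      along an arc to a vertex dominated by x_i, hence to x_{i+1};
--  (2) an arc into a dominator would close a cycle with any out-branching;
--  (3) every vertex of a block below x_i is dominated by x_i.

open import Defs
open import Data.Nat using (ℕ; suc; _+_; _<_)
open import Data.Nat.Properties
  using (≤-pred; ≤-trans; n≤1+n; +-suc; +-monoʳ-≤; m<1+n⇒m<n∨m≡n; module ≤-Reasoning)
open import Data.Fin using (Fin; _≟_)
open import Data.List using (List; []; _∷_; _++_; allFin)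
open import Data.List.Membership.Propositional using (_∈_; _∉_; lose)
open import Data.List.Membership.Propositional.Properties using (∈-++⁺ˡ; ∈-++⁺ʳ; ∈-allFin)
open import Data.List.Relation.Unary.Any using (Any; here; there; any?)
open import Data.List.Relation.Unary.All using (All; []; _∷_; lookup)
open import Data.List.Relation.Unary.All.Properties using (¬Any⇒All¬; All¬⇒¬Any)
open import Data.List.Relation.Unary.AllPairs using ([]; _∷_)
open import Data.Product using (Σ-syntax; ∃-syntax; _×_; _,_; proj₁; proj₂)
open import Data.Sum using (_⊎_; inj₁; inj₂; [_,_]′; map₁)
open import Data.Empty using (⊥; ⊥-elim)
open import Data.Unit using (tt)
open import Level using (0ℓ)
open import Function using (_∘_; id)
open import Effect.Monad using (RawMonad)
open import Relation.Nullary using (¬_; Dec; yes; no)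
open import Relation.Nullary.Decidable using (decidable-stable; _⊎-dec_; ¬¬-excluded-middle)
open import Relation.Nullary.Negation using (¬¬-Monad)
open import Relation.Binary.PropositionalEquality
  using (_≡_; _≢_; refl; sym; trans; cong; subst; subst₂)
open import Relation.Binary.Construct.Closure.ReflexiveTransitive using (Star; ε; _◅_)

open RawMonad (¬¬-Monad {0ℓ}) using (pure; _>>=_)

module WalkToolkit {n : ℕ} {R : Rel n} where
  open import Data.List.Membership.DecPropositional (_≟_ {n}) using (_∈?_)

  init : ∀ {S u v} → Walk R S u v → List (Fin n)
  init [ _ ]            = []
  init (step {u} _ _ p) = u ∷ init p

  tail : ∀ {S u v} → Walk R S u v → List (Fin n)
  tail [ _ ]        = []
  tail (step _ _ p) = verts R p

  verts-tail : ∀ {S u v} (p : Walk R S u v) → verts R p ≡ u ∷ tail p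
  verts-tail [ _ ]        = refl
  verts-tail (step _ _ p) = refl

  head∈ : ∀ {S u v} (p : Walk R S u v) → u ∈ verts R p
  head∈ p = subst (_ ∈_) (sym (verts-tail p)) (here refl)

  last∈ : ∀ {S u v} (p : Walk R S u v) → v ∈ verts R p
  last∈ [ _ ]        = here refl
  last∈ (step _ _ p) = there (last∈ p)

  ∈-init : ∀ {S u v w} (p : Walk R S u v) → w ∈ verts R p → w ∈ init p ⊎ w ≡ v
  ∈-init [ _ ]        (here refl) = inj₂ refl
  ∈-init (step _ _ p) (here refl) = inj₁ (here refl)
  ∈-init (step _ _ p) (there m)   = map₁ there (∈-init p m)

  arcInto : ∀ {S u v z} (p : Walk R S u v) → z ∈ tail p → ∃[ w ] (w ∈ verts R p × R w z)
  arcInto (step _ e p) m with subst (_ ∈_) (verts-tail p) m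
  ... | here refl = _ , here refl , e
  ... | there m'  = let (w , w∈p , e') = arcInto p m' in w , there w∈p , e'

  _++w_ : ∀ {S u v w} → Walk R S u v → Walk R S v w → Walk R S u w
  [ _ ]        ++w q = q
  step su e p ++w q = step su e (p ++w q)

  ∈-++w : ∀ {S u v w z} (p : Walk R S u v) (q : Walk R S v w) →
          z ∈ verts R (p ++w q) → z ∈ verts R p ⊎ z ∈ verts R q
  ∈-++w [ _ ]        q m         = inj₂ m
  ∈-++w (step _ _ p) q (here refl) = inj₁ (here refl)
  ∈-++w (step _ _ p) q (there m) = map₁ there (∈-++w p q m)

  record Split {S u v} (p : Walk R S u v) (z : Fin n) : Set where
    constructor split
    field
      before : Walk R S u z
      after  : Walk R S z v
      splits : verts R p ≡ init before ++ verts R after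
  open Split public

  before⊆ : ∀ {S u v z w} {p : Walk R S u v} (sp : Split p z) →
            w ∈ verts R (before sp) → w ∈ verts R p
  before⊆ (split q r eq) m with ∈-init q m
  ... | inj₁ m'   = subst (_ ∈_) (sym eq) (∈-++⁺ˡ m')
  ... | inj₂ refl = subst (_ ∈_) (sym eq) (∈-++⁺ʳ (init q) (head∈ r))

  after⊆ : ∀ {S u v z w} {p : Walk R S u v} (sp : Split p z) →
           w ∈ verts R (after sp) → w ∈ verts R p
  after⊆ (split q r eq) m = subst (_ ∈_) (sym eq) (∈-++⁺ʳ (init q) m)

  firstHit : ∀ {S u v} {P : Fin n → Set} → (∀ z → Dec (P z)) →
             (p : Walk R S u v) → Any P (verts R p) →
             ∃[ z ] (P z × Σ[ sp ∈ Split p z ] All (¬_ ∘ P) (init (before sp)))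
  firstHit P? [ su ] (here pz) = _ , pz , split [ su ] [ su ] refl , []
  firstHit P? (step {u} su e p) h with P? u
  ... | yes pu = u , pu , split [ su ] (step su e p) refl , []
  ... | no ¬pu with h
  ...   | here pu  = ⊥-elim (¬pu pu)
  ...   | there h' with firstHit P? p h'
  ...     | z , pz , split q r eq , avoid =
              z , pz , split (step su e q) r (cong (u ∷_) eq) , ¬pu ∷ avoid

  lastHit : ∀ {S u v} {P : Fin n → Set} → (∀ z → Dec (P z)) →
            (p : Walk R S u v) → Any P (verts R p) →
            ∃[ z ] (P z × Σ[ sp ∈ Split p z ] All (¬_ ∘ P) (tail (after sp)))
  lastHit P? [ su ] (here pz) = _ , pz , split [ su ] [ su ] refl , []
  lastHit P? (step {u} su e p) h with any? P? (verts R p)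
  ... | yes h' with lastHit P? p h'
  ...   | z , pz , split q r eq , avoid = z , pz , split (step su e q) r (cong (u ∷_) eq) , avoid
  lastHit P? (step {u} su e p) h | no ¬h' with h
  ...   | here pu  = u , pu , split [ su ] (step su e p) refl , ¬Any⇒All¬ _ ¬h'
  ...   | there h' = ⊥-elim (¬h' h')

  splitAt : ∀ {S u v x} (p : Walk R S u v) → x ∈ verts R p → Split p x
  splitAt {x = x} p m with firstHit (x ≟_) p m
  ... | _ , refl , sp , _ = sp

  toPath : ∀ {S u v} (p : Walk R S u v) →
           Σ[ q ∈ Walk R S u v ] (IsPath R q × (∀ {z} → z ∈ verts R q → z ∈ verts R p))
  toPath [ su ] = [ su ] , [] ∷ [] , id
  toPath (step {u} su e p) with toPath p
  ... | q , q-path , q⊆p with u ∈? verts R q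
  ...   | no u∉q = step su e q , ¬Any⇒All¬ _ u∉q ∷ q-path ,
                   λ { (here refl) → here refl ; (there m) → there (q⊆p m) }
  ...   | yes u∈q = let (r , r-path , r⊆q) = dropTo q q-path u∈q in
                    r , r-path , there ∘ q⊆p ∘ r⊆q
    where
    dropTo : ∀ {S a b z} (q : Walk R S a b) → IsPath R q → z ∈ verts R q →
             Σ[ r ∈ Walk R S z b ] (IsPath R r × (∀ {w} → w ∈ verts R r → w ∈ verts R q))
    dropTo q@([ _ ])      q-path       (here refl) = q , q-path , id
    dropTo q@(step _ _ _) q-path       (here refl) = q , q-path , id
    dropTo (step _ _ q)   (_ ∷ q-path) (there m)   =
      let (r , r-path , r⊆q) = dropTo q q-path m in r , r-path , there ∘ r⊆q

open WalkToolkit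

module _ {n : ℕ} where

  mapWalk : ∀ {R R' : Rel n} {S S' : Fin n → Set} → (∀ {a b} → R a b → R' a b) →
            ∀ {u v} (p : Walk R S u v) → (∀ {z} → z ∈ verts R p → S' z) → Walk R' S' u v
  mapWalk f [ _ ]        h = [ h (here refl) ]
  mapWalk f (step _ e p) h = step (h (here refl)) (f e) (mapWalk f p (h ∘ there))

  verts-mapWalk : ∀ {R R' : Rel n} {S S' : Fin n → Set} (f : ∀ {a b} → R a b → R' a b) →
                  ∀ {u v} (p : Walk R S u v) (h : ∀ {z} → z ∈ verts R p → S' z) →
                  verts R' (mapWalk f p h) ≡ verts R p
  verts-mapWalk f [ _ ]        h = refl
  verts-mapWalk f (step _ e p) h = cong (_ ∷_) (verts-mapWalk f p (h ∘ there))

  starWalk : ∀ {R : Rel n} {a b} → Star R a b → Walk R (Full R) a b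
  starWalk ε        = [ tt ]
  starWalk (e ◅ es) = step tt e (starWalk es)

¬¬-all∈ : ∀ {X : Set} {P : X → Set} (l : List X) →
          (∀ {z} → z ∈ l → ¬ ¬ P z) → ¬ ¬ (∀ {z} → z ∈ l → P z)
¬¬-all∈ []      h = pure (λ ())
¬¬-all∈ (a ∷ l) h = do
  pa ← h (here refl)
  pl ← ¬¬-all∈ l (h ∘ there)
  pure λ { (here refl) → pa ; (there m) → pl m }

¬¬-decidable : ∀ {n} (P : Fin n → Set) → ¬ ¬ (∀ z → Dec (P z))
¬¬-decidable {n} P = do
  dec ← ¬¬-all∈ (allFin n) (λ _ → ¬¬-excluded-middle)
  pure (λ z → dec (∈-allFin z))

module OutBranching {n : ℕ} {A F : Rel n} {s : Fin n} (ob : IsOutBranching A s F) where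

  F⊆A : ∀ {a b} → F a b → A a b
  F⊆A {a} {b} = proj₁ ob a b

  rootless : ∀ u → ¬ F u s
  rootless = proj₁ (proj₂ ob)

  uniqueInArc : ∀ v → v ≢ s → ∃[ u ] (F u v × (∀ w → F w v → w ≡ u))
  uniqueInArc = proj₁ (proj₂ (proj₂ ob))

  spanning : ∀ v → Star F s v
  spanning = proj₂ (proj₂ (proj₂ ob))

  branch : ∀ v → Walk F (Full F) s v
  branch v = starWalk (spanning v)

  reach : ∀ v → Walk A (Full A) s v
  reach v = mapWalk F⊆A (branch v) (λ _ → tt)

  -- F has no cycle: the vertex set of a cycle is closed under taking the
  -- (unique) in-arc, so it would contain the root s, which has none
  acyclic : ∀ {T a b} (r : Walk F T a b) → ¬ F b a
  acyclic {T} {a} {b} r ba = let (_ , _ , into-s) = inArc s s-on-cycle in rootless _ into-s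
    where
    OnCycle : Fin n → Set
    OnCycle z = z ∈ verts F r

    inArc : ∀ z → OnCycle z → ∃[ w ] (OnCycle w × F w z)
    inArc z m with subst (_ ∈_) (verts-tail r) m
    ... | here refl = b , last∈ r , ba
    ... | there m'  = arcInto r m'

    backwards : ∀ {u z} → Star F u z → OnCycle z → OnCycle u
    backwards ε c = c
    backwards {u} (_◅_ {j = u'} e es) c with inArc u' (backwards es c) | u' ≟ s
    ... | _ | yes refl = ⊥-elim (rootless u e)
    ... | w , w∈r , we | no u'≢s =
      let (_ , _ , unique) = uniqueInArc u' u'≢s in
      subst OnCycle (trans (unique w we) (sym (unique u e))) w∈r

    s-on-cycle : OnCycle s
    s-on-cycle = backwards (spanning a) (head∈ r)

monotone-child : ∀ {n} {A : Rel n} {s : Fin n} {x : ℕ → Fin n} {ℓ : ℕ} →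
                 MonotonePath A s x ℓ → ∀ i → suc i < ℓ → Child A s (x i) (x (suc i))
monotone-child {A = A} {s} {ℓ = ℓ} (_ , y , m , k , (_ , isChild , _) , k+ℓ≤1+m , x≡y) i i+1<ℓ =
  subst₂ (Child A s) (sym (x≡y i (≤-trans (n≤1+n _) i+1<ℓ)))
         (sym (trans (x≡y (suc i) i+1<ℓ) (cong y (+-suc k i))))
         (isChild (k + i) k+i<m)
  where
  open ≤-Reasoning
  k+i<m : k + i < m
  k+i<m = ≤-pred (begin
    suc (suc (k + i)) ≡⟨ sym (trans (+-suc k (suc i)) (cong suc (+-suc k i))) ⟩
    k + suc (suc i)   ≤⟨ +-monoʳ-≤ k i+1<ℓ ⟩
    k + ℓ             ≤⟨ k+ℓ≤1+m ⟩
    suc m             ∎)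

module Domination {n : ℕ} (A : Rel n) (s : Fin n) (reach : ∀ v → Walk A (Full A) s v) where
  open import Data.List.Membership.DecPropositional (_≟_ {n}) using (_∈?_)

  Dominates : Fin n → Fin n → Set
  Dominates x v = (p : Walk A (Full A) s v) → x ∈ verts A p

  _⊆A : Rel n → Set
  R ⊆A = ∀ {a b} → R a b → A a b

  inD : ∀ {R T u v} → R ⊆A → Walk R T u v → Walk A (Full A) u v
  inD f p = mapWalk f p (λ _ → tt)

  dom-refl : ∀ v → Dominates v v
  dom-refl v = last∈

  dom-walk : ∀ {R T x v} → R ⊆A → Dominates x v → (p : Walk R T s v) → x ∈ verts R p
  dom-walk f x⊳v p = subst (_ ∈_) (verts-mapWalk f p _) (x⊳v (inD f p))

  dom-back : ∀ {R T x w v} → R ⊆A → Dominates x v → (r : Walk R T w v) → x ∉ verts R r →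
             Dominates x w
  dom-back {x = x} f x⊳v r x∉r p with x ∈? verts A p
  ... | yes x∈p = x∈p
  ... | no  x∉p = ⊥-elim ([ x∉p , x∉r ∘ subst (_ ∈_) (verts-mapWalk f r _) ]′
                            (∈-++w p (inD f r) (x⊳v (p ++w inD f r))))

  dom-trans : ∀ {x y v} → Dominates x y → Dominates y v → Dominates x v
  dom-trans x⊳y y⊳v p = let sp = splitAt p (y⊳v p) in before⊆ sp (x⊳y (before sp))

  -- look at the first visit of x or y on a walk to x
  dom-antisym : ∀ {x y} → Dominates x y → Dominates y x → x ≡ y
  dom-antisym {x} {y} x⊳y y⊳x
    with firstHit (λ z → (z ≟ x) ⊎-dec (z ≟ y)) (reach x) (lose (last∈ (reach x)) (inj₁ refl))
  ... | _ , inj₁ refl , sp , avoid with ∈-init (before sp) (y⊳x (before sp))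
  ...   | inj₁ y∈ = ⊥-elim (lookup avoid y∈ (inj₂ refl))
  ...   | inj₂ y≡x = sym y≡x
  dom-antisym {x} {y} x⊳y y⊳x
      | _ , inj₂ refl , sp , avoid with ∈-init (before sp) (x⊳y (before sp))
  ...   | inj₁ x∈ = ⊥-elim (lookup avoid x∈ (inj₁ refl))
  ...   | inj₂ x≡y = x≡y

  dom-avoiding : ∀ {R T x w v} → R ⊆A → Dominates x v → (r : Walk R T w v) → x ∉ verts R r →
                 ∀ {z} → z ∈ verts R r → Dominates x z
  dom-avoiding f x⊳v r@([ _ ])      x∉r (here refl) = dom-back f x⊳v r x∉r
  dom-avoiding f x⊳v r@(step _ _ _) x∉r (here refl) = dom-back f x⊳v r x∉r
  dom-avoiding f x⊳v (step _ _ r) x∉r (there m) = dom-avoiding f x⊳v r (x∉r ∘ there) m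

  dom-after-last : ∀ {R T x v} → R ⊆A → Dominates x v → (r : Walk R T x v) →
                   All (x ≢_) (tail r) → ∀ {z} → z ∈ verts R r → Dominates x z
  dom-after-last f x⊳v [ _ ]        _     (here refl) = dom-refl _
  dom-after-last f x⊳v (step _ _ _) _     (here refl) = dom-refl _
  dom-after-last f x⊳v (step _ _ r) avoid (there m) = dom-avoiding f x⊳v r (All¬⇒¬Any avoid) m

  -- if x strictly dominates y, then y dominates no vertex of B_x but itself:
  -- each such vertex is reached from x by a walk avoiding y
  block-undominated : ∀ {S x y z} → Dominates x y → y ≢ x → Diblock A S x z → z ≢ y →
                      ¬ Dominates y z
  block-undominated x⊳y y≢x (_ , inj₁ refl) z≢y y⊳x = y≢x (sym (dom-antisym x⊳y y⊳x))
  block-undominated x⊳y y≢x (_ , inj₂ (inj₁ xz)) z≢y y⊳z =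
    y≢x (sym (dom-antisym x⊳y (dom-back id y⊳z (step tt xz [ tt ]) y∉xz)))
    where
    y∉xz : _ ∉ _
    y∉xz (here y≡x)          = y≢x y≡x
    y∉xz (there (here y≡z)) = z≢y (sym y≡z)
  block-undominated {y = y} x⊳y y≢x (_ , inj₂ (inj₂ (p₁ , p₂ , _ , _ , disjoint))) z≢y y⊳z
    with y ∈? verts A p₁ | y ∈? verts A p₂
  ... | no y∉p₁ | _       = y≢x (sym (dom-antisym x⊳y (dom-back id y⊳z p₁ y∉p₁)))
  ... | yes _   | no y∉p₂ = y≢x (sym (dom-antisym x⊳y (dom-back id y⊳z p₂ y∉p₂)))
  ... | yes y∈p₁ | yes y∈p₂ = [ y≢x , z≢y ∘ sym ]′ (disjoint y y∈p₁ y∈p₂)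

  record NodeInvariant (x : Fin n) (S : Fin n → Set) : Set where
    field
      root∈     : S x
      dominated : ∀ {v} → S v → Dominates x v
      saturated : ∀ {v} → Dominates x v → ¬ ¬ S v

  pathInside : ∀ {x S v} → NodeInvariant x S → Dominates x v → (p : Walk A (Full A) s v) →
               ¬ ¬ (Σ[ q ∈ Walk A S x v ] (IsPath A q × (∀ {z} → z ∈ verts A q → z ∈ verts A p)))
  pathInside {x} inv x⊳v p with lastHit (x ≟_) p (x⊳v p)
  ... | _ , refl , sp , avoid = do
    let r = after sp
    inS ← ¬¬-all∈ (verts A r) (λ m → NodeInvariant.saturated inv (dom-after-last id x⊳v r avoid m))
    let (q , q-path , q⊆r) = toPath (mapWalk id r inS)
    pure (q , q-path , λ {_} m → after⊆ sp (subst (_ ∈_) (verts-mapWalk id r inS) (q⊆r m)))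

  invariant-step : ∀ {x S y} → NodeInvariant x S → Bottleneck A S x y →
                   NodeInvariant y (Sub A S x y)
  invariant-step {x} {S} {y} inv (y∈B , y≢x , _) =
    record { root∈ = inj₂ refl ; dominated = dominated′ ; saturated = saturated′ }
    where
    open NodeInvariant inv
    B = Diblock A S x

    x⊳y : Dominates x y
    x⊳y = dominated (proj₁ y∈B)

    -- every path of D[S] from x to v ∈ X_y passes through y
    dominated′ : ∀ {v} → Sub A S x y v → Dominates y v
    dominated′ (inj₂ refl) = dom-refl y
    dominated′ (inj₁ (v∈S , _ , _ , lastMeets)) p = decidable-stable (y ∈? verts A p) λ y∉p →
      pathInside inv (dominated v∈S) p λ (q , q-path , q⊆p) →
        let (_ , pre , _ , q≡ , _) = lastMeets q q-path in
        y∉p (q⊆p (subst (y ∈_) (sym q≡) (∈-++⁺ʳ pre (here refl))))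

    lastInBlock : ∀ {v} → Dominates y v → (∀ z → Dec (B z)) → (q : Walk A S x v) →
                  LastMeets A B q y
    lastInBlock y⊳v B? q with lastHit B? q (lose (head∈ q) (root∈ , inj₁ refl))
    ... | z , z∈B , split q₁ r q≡ , avoidB with z ≟ y
    ...   | yes refl = z∈B , init q₁ , tail r , trans q≡ (cong (init q₁ ++_) (verts-tail r)) , avoidB
    ...   | no z≢y = ⊥-elim (block-undominated x⊳y y≢x z∈B z≢y (dom-back id y⊳v r y∉r))
      where
      y∉r : y ∉ verts A r
      y∉r m with subst (y ∈_) (verts-tail r) m
      ... | here y≡z = z≢y (sym y≡z)
      ... | there m' = lookup avoidB m' y∈B

    saturated′ : ∀ {v} → Dominates y v → ¬ ¬ Sub A S x y v
    saturated′ {v} y⊳v with v ≟ y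
    ... | yes refl = pure (inj₂ refl)
    ... | no v≢y = do
      let x⊳v = dom-trans x⊳y y⊳v
      v∈S ← saturated x⊳v
      (q , _ , _) ← pathInside inv x⊳v (reach v)
      B? ← ¬¬-decidable B
      pure (inj₁ (v∈S , (λ v∈B → block-undominated x⊳y y≢x v∈B v≢y y⊳v) , q ,
                  λ q′ _ → lastInBlock y⊳v B? q′))

  nodeInvariant : ∀ {x S} → DecNode A (Full A) s x S → NodeInvariant x S
  nodeInvariant root = record
    { root∈ = tt ; dominated = λ _ p → head∈ p ; saturated = λ _ → pure tt }
  nodeInvariant (child node b) = invariant-step (nodeInvariant node) b

  child-dominated : ∀ {x y} → Child A s x y → Dominates x y × y ≢ x
  child-dominated (_ , node , (y∈B , y≢x , _)) =
    NodeInvariant.dominated (nodeInvariant node) (proj₁ y∈B) , y≢x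

  descendant-dominated : ∀ {x y} → Descendant A s x y → Dominates x y
  descendant-dominated ε        = dom-refl _
  descendant-dominated (c ◅ cs) = dom-trans (proj₁ (child-dominated c)) (descendant-dominated cs)

  block-dominated : ∀ {x v} → InBlock A s x v → Dominates x v
  block-dominated (_ , node , v∈B) = NodeInvariant.dominated (nodeInvariant node) (proj₁ v∈B)

  monotone-dominates : ∀ {x : ℕ → Fin n} {ℓ : ℕ} → MonotonePath A s x ℓ →
                       ∀ i j → i < j → j < ℓ → Dominates (x i) (x j)
  monotone-dominates mono i (suc j) i<j+1 j+1<ℓ with m<1+n⇒m<n∨m≡n i<j+1
  ... | inj₁ i<j  = dom-trans (monotone-dominates mono i j i<j (≤-trans (n≤1+n _) j+1<ℓ))
                              (proj₁ (child-dominated (monotone-child mono j j+1<ℓ)))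
  ... | inj₂ refl = proj₁ (child-dominated (monotone-child mono i j+1<ℓ))

  two-element : ∀ {a b p q r : Fin n} → p ≢ q → p ≢ r → q ≢ r →
                (p ≡ a ⊎ p ≡ b) → (q ≡ a ⊎ q ≡ b) → (r ≡ a ⊎ r ≡ b) → ⊥
  two-element p≢q p≢r q≢r (inj₁ refl) (inj₁ refl) _ = p≢q refl
  two-element p≢q p≢r q≢r (inj₂ refl) (inj₂ refl) _ = p≢q refl
  two-element p≢q p≢r q≢r (inj₁ refl) _ (inj₁ refl) = p≢r refl
  two-element p≢q p≢r q≢r (inj₂ refl) _ (inj₂ refl) = p≢r refl
  two-element p≢q p≢r q≢r _ (inj₁ refl) (inj₁ refl) = q≢r refl
  two-element p≢q p≢r q≢r _ (inj₂ refl) (inj₂ refl) = q≢r refl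

  -- if B_x is degenerate with child y, then y is the only out-neighbour of
  -- x dominated by x: any other one would be a third vertex of B_x
  degenerate-out-neighbour : (∀ v → ¬ A v v) → ∀ {x y w} → DegenerateBlock A s x →
                             Child A s x y → A x w → Dominates x w → w ≡ y
  degenerate-out-neighbour irr {x} {y} {w} (_ , a , b , _ , blockIs) (S , node , (y∈B , y≢x , _)) xw x⊳w =
    decidable-stable (w ≟ y) λ w≢y → saturated x⊳w λ w∈S →
      two-element (y≢x ∘ sym) (λ x≡w → irr x (subst (A x) (sym x≡w) xw)) (w≢y ∘ sym)
        (inBlock (root∈ , inj₁ refl)) (inBlock y∈B) (inBlock (w∈S , inj₂ (inj₁ xw)))
    where
    open NodeInvariant (nodeInvariant node)
    inBlock : ∀ {v} → Diblock A S x v → v ≡ a ⊎ v ≡ b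
    inBlock {v} v∈B = proj₁ (blockIs v) (S , node , v∈B)

  -- (1) an out-branching F contains the arc from a degenerate node x to its
  -- child y: the branch of F towards y leaves x for the last time along an
  -- arc to a vertex dominated by x, which must be y
  branching-contains-child-arc : (∀ v → ¬ A v v) → ∀ {F x y} → IsOutBranching A s F →
                                 DegenerateBlock A s x → Child A s x y → F x y
  branching-contains-child-arc irr {F} {x} {y} ob deg c
    with lastHit (x ≟_) (OutBranching.branch ob y)
                 (dom-walk (OutBranching.F⊆A ob) (proj₁ (child-dominated c)) (OutBranching.branch ob y))
  ... | _ , refl , split _ [ _ ] _ , _ = ⊥-elim (proj₂ (child-dominated c) refl)
  ... | _ , refl , split _ (step _ xw r) _ , avoid =
    subst (F x) (degenerate-out-neighbour irr deg c (F⊆A xw) x⊳w) xw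
    where
    open OutBranching ob
    x⊳w = dom-back F⊆A (proj₁ (child-dominated c)) r (All¬⇒¬Any avoid)

  -- (2) an arc into a dominator lies in no out-branching, since together
  -- with the branch from its head to its tail it would form a cycle
  arc-into-dominator : ∀ {x v} → Dominates x v → A v x → InRs A s v x
  arc-into-dominator {x} {v} x⊳v vx = vx , λ F ob vx∈F →
    let open OutBranching ob
        x∈branch = dom-walk F⊆A x⊳v (branch v)
    in acyclic (after (splitAt (branch v) x∈branch)) vx∈F

  -- (3) the only arc from a degenerate node x into a block below x is the
  -- arc to its child, since x dominates every vertex of such a block
  degenerate-arcs-below : (∀ v → ¬ A v v) → ∀ {x y z v} → DegenerateBlock A s x →
                          Child A s x y → Descendant A s x z → InBlock A s z v → A x v → v ≡ y
  degenerate-arcs-below irr deg c desc v∈B xv =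
    degenerate-out-neighbour irr deg c xv (dom-trans (descendant-dominated desc) (block-dominated v∈B))

lemma14 : ∀ {n} (A : Rel n) (s t : Fin n) →
    (∀ v → ¬ A v v) →
    Reduced A s t →
    (x : ℕ → Fin n) (ℓ : ℕ) →
    DegeneratePath A s x ℓ →
    (∀ F → IsOutBranching A s F → ∀ i → suc i < ℓ → F (x i) (x (suc i)))
    × (∀ i j → i < j → j < ℓ → A (x j) (x i) → InRs A s (x j) (x i))
    × (∀ i → suc i < ℓ → ∀ y → Descendant A s (x i) y →
         ∀ v → InBlock A s y v → A (x i) v → v ≡ x (suc i))
lemma14 A s t irr ((_ , ob) , _) x ℓ (mono , degenerate) =
  (λ F obF i i+1<ℓ → branching-contains-child-arc irr obF (degenerateAt i+1<ℓ) (childAt i+1<ℓ)) ,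
  (λ i j i<j j<ℓ → arc-into-dominator (monotone-dominates mono i j i<j j<ℓ)) ,
  (λ i i+1<ℓ _ desc _ v∈B → degenerate-arcs-below irr (degenerateAt i+1<ℓ) (childAt i+1<ℓ) desc v∈B)
  where
  open OutBranching ob using (reach)
  open Domination A s reach

  degenerateAt : ∀ {i} → suc i < ℓ → DegenerateBlock A s (x i)
  degenerateAt i+1<ℓ = degenerate _ (≤-trans (n≤1+n _) i+1<ℓ)

  childAt : ∀ {i} → suc i < ℓ → Child A s (x i) (x (suc i))
  childAt = monotone-child mono _
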